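{- Let $(g,f_1,f_2)$ be a Sprugnoli array with matrix $M$, let $\overline{M}$ be $M$ with its top row removed, and let $P=M^{ -1}\overline{M}$ be its production matrix. Let $A(x)=\sum_{n\ge0}P_{n,1}x^n$ (generating function of column $1$ of $P$) and let $B(x)$ be defined by $xB(x)=\sum_{n\ge0}P_{n,2}x^n$ (generating function of column $2$ of $P$), columns indexed from $0$. Then $A(x)+B(x)$ is an even power series (contains only even powers of $x$).
   Context: All power series are formal power series over a field $\mathbb{K}$ of characteristic $0$. $\mathcal{F}_r$ denotes the set of power series $\sum_{n\ge r}a_nx^n$ with $a_r\ne0$. A Sprugnoli array is a triple $(g,f_1,f_2)$ with $g\in\mathcal{F}_0$, $f_1\in\mathcal{F}_1$, $f_2\in\mathcal{F}_1$ and $f_2$ odd (only odd powers of $x$); its matrix is the lower-triangular matrix $(t_{n,k})_{n,k\ge0}$ with $t_{n,k}=[x^n]\,g(x)f_1(x)^{k\bmod 2}(xf_2(x))^{\lfloor k/2\rfloor}$, which is invertible. -}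

module Defs where

open import Level using (Level; _⊔_) renaming (suc to lsuc)
open import Algebra.Bundles using (CommutativeRing)
open import Data.Nat using (ℕ; zero; suc; _≡ᵇ_; _%_; _/_) renaming (_*_ to _*ℕ_; _∸_ to _∸ℕ_)
open import Data.Product using (_×_)
open import Data.Empty.Polymorphic using () renaming (⊥ to ⊥')
open import Data.Bool using (if_then_else_)
open import Relation.Nullary using (¬_)
open import Relation.Binary.PropositionalEquality using (_≡_)

-- A field: a commutative ring with 0 ≠ 1 in which every nonzero element has
-- a multiplicative inverse (inverse given as a total operation, its value at 0
-- being irrelevant).
record Field (c ℓ : Level) : Set (lsuc (c ⊔ ℓ)) where
  field
    commutativeRing : CommutativeRing c ℓ
  open CommutativeRing commutativeRing public
  field
    _⁻¹       : Carrier → Carrier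
    ⁻¹-inverse : ∀ x → ¬ (x ≈ 0#) → (x * (x ⁻¹)) ≈ 1#
    0≉1       : ¬ (0# ≈ 1#)

module Sprugnoli {c ℓ : Level} (F : Field c ℓ) where
  open Field F

  natCast : ℕ → Carrier
  natCast zero    = 0#
  natCast (suc n) = 1# + natCast n

  CharZero : Set ℓ
  CharZero = ∀ n → natCast (suc n) ≈ 0# → ⊥' {ℓ}

  Σ< : ℕ → (ℕ → Carrier) → Carrier
  Σ< zero    f = 0#
  Σ< (suc n) f = Σ< n f + f n

  Series : Set c
  Series = ℕ → Carrier

  oneS : Series
  oneS zero    = 1#
  oneS (suc n) = 0#

  xS : Series → Series
  xS f zero    = 0#
  xS f (suc n) = f n

  _·_ : Series → Series → Series
  (a · b) n = Σ< (suc n) (λ i → a i * b (n ∸ℕ i))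

  powS : Series → ℕ → Series
  powS a zero    = oneS
  powS a (suc k) = a · powS a k

  InF0 : Series → Set ℓ
  InF0 f = ¬ (f 0 ≈ 0#)

  InF1 : Series → Set ℓ
  InF1 f = (f 0 ≈ 0#) × ¬ (f 1 ≈ 0#)

  OddSeries : Series → Set ℓ
  OddSeries f = ∀ n → f (2 *ℕ n) ≈ 0#

  EvenSeries : Series → Set ℓ
  EvenSeries f = ∀ n → f (suc (2 *ℕ n)) ≈ 0#

  _+S_ : Series → Series → Series
  (a +S b) n = a n + b n

  Matrix : Set c
  Matrix = ℕ → ℕ → Carrier

  sprugnoliMatrix : Series → Series → Series → Matrix
  sprugnoliMatrix g f1 f2 n k = ((g · powS f1 (k % 2)) · powS (xS f2) (k / 2)) n

  module _ (T : Matrix) where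
    δ : ℕ → ℕ → Carrier
    δ n k = if n ≡ᵇ k then 1# else 0#

    newRow : Matrix → ℕ → ℕ → Carrier
    newRow R n k = (T n n ⁻¹) * (δ n k - Σ< n (λ j → T n j * R j k))

    -- invUpTo n j k is correct for rows j ≤ n
    invUpTo : ℕ → Matrix
    invUpTo zero    j k = newRow (λ _ _ → 0#) 0 k
    invUpTo (suc n) j k = if j ≡ᵇ suc n then newRow (invUpTo n) (suc n) k
                                        else invUpTo n j k

    lowerTriInverse : Matrix
    lowerTriInverse n k = invUpTo n n k

  -- production matrix P = M^{-1} M̄, where M̄_{n,k} = M_{n+1,k} (top row removed);
  -- since M^{-1} is lower triangular, the sum over j is finite (j ≤ n).
  productionMatrix : Matrix → Matrix
  productionMatrix M n k =
    Σ< (suc n) (λ j → lowerTriInverse M n j * M (suc j) k)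

  seriesA : Matrix → Series
  seriesA P n = P n 1

  -- B(x) with x B(x) = Σ P_{n,2} x^n, i.e. [x^n] B = P_{n+1,2}
  seriesB : Matrix → Series
  seriesB P n = P (suc n) 2

-- Column i of M has generating function g wᵢ with w₂ₖ = uᵏ, w₂ₖ₊₁ = f1 uᵏ, where u = x f2 is
-- even. From M P = M̄, column k of P is the vector c with g Σ cᵢ wᵢ = (column k of M) / x;
-- cancelling g, Σᵢ P_{i,1} wᵢ = f1 / x and Σᵢ P_{i,2} wᵢ = f2. Now Σ cᵢ wᵢ = E(c) + O(c) f1 with
-- even series E(c) = Σ c₂ₖ uᵏ, O(c) = Σ c₂ₖ₊₁ uᵏ; split f1 = e + o into even and odd parts and
-- write E₂, O₂, O₁ for E and O of columns 2, 2, 1 of P. Comparing parts: f2 = O₂ o,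
-- 0 = E₂ + O₂ e and odd(f1 / x) = O₁ o. Multiplying the last by u = x f2, and using
-- x · odd(f1 / x) = e, gives u O₁ o = f2 e = O₂ e o; cancelling o (of order 1),
-- u O₁ = O₂ e = −E₂, i.e. Σₖ (P_{2k,2} + P_{2k−1,1}) uᵏ = 0. As uᵏ has order exactly 2k,
-- every P_{2m+2,2} + P_{2m+1,1} = [x^{2m+1}] (A + B) vanishes.

module Submission where

open import Defs
open import Level using (Level)
open import Data.Bool using (Bool; true; false; not; if_then_else_)
open import Data.Bool.Properties using () renaming (_≟_ to _≟ᵇ_)
open import Data.Nat as ℕ using (ℕ; zero; suc; _∸_; _≤_; _<_; z≤n; s≤s)
import Data.Nat.Properties as ℕₚ
open import Data.Nat.DivMod using (m/n≡1+[m∸n]/n)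
open import Data.Nat.Induction using (<-rec)
open import Data.Product using (_,_; proj₁; proj₂; ∃-syntax)
open import Data.Sum using (inj₁; inj₂)
open import Relation.Nullary using (¬_; does; yes; no; contradiction)
open import Relation.Nullary.Decidable using (dec-true; dec-false)
open import Relation.Binary.Bundles using (Setoid)
open import Relation.Binary.Structures using (IsEquivalence)
open import Relation.Binary.Definitions using (tri<; tri≈; tri>)
open import Relation.Binary.PropositionalEquality as ≡ using (_≡_; _≢_; cong)
import Relation.Binary.Reasoning.Setoid as ≈-Reasoning
open import Algebra.Bundles using (CommutativeSemigroup)
import Algebra.Properties.CommutativeSemigroup as CommutativeSemigroupProperties
import Algebra.Properties.Group as GroupProperties

isEven : ℕ → Bool
isEven zero          = true
isEven (suc zero)    = false
isEven (suc (suc n)) = isEven n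

isEven-suc : ∀ n → isEven (suc n) ≡ not (isEven n)
isEven-suc zero          = ≡.refl
isEven-suc (suc zero)    = ≡.refl
isEven-suc (suc (suc n)) = isEven-suc n

isEven-∸ : ∀ {n i} → i ≤ n → isEven i ≡ true → isEven (n ∸ i) ≡ isEven n
isEven-∸ {i = zero}        _                 _  = ≡.refl
isEven-∸ {i = suc zero}    _                 ()
isEven-∸ {i = suc (suc i)} (s≤s (s≤s i≤n)) ev = isEven-∸ i≤n ev

isEven-pred : ∀ n → isEven (suc n) ≡ false → isEven n ≡ true
isEven-pred zero          _     = ≡.refl
isEven-pred (suc zero)    ()
isEven-pred (suc (suc n)) n-odd = isEven-pred n n-odd

double : ℕ → ℕ
double zero    = zero
double (suc n) = suc (suc (double n))

double≡2* : ∀ n → double n ≡ 2 ℕ.* n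
double≡2* zero    = ≡.refl
double≡2* (suc n) = cong suc (≡.trans (cong suc (double≡2* n)) (≡.sym (ℕₚ.+-suc n (n ℕ.+ 0))))

isEven⇒double : ∀ n → isEven n ≡ true → ∃[ k ] double k ≡ n
isEven⇒double zero          _  = 0 , ≡.refl
isEven⇒double (suc zero)    ()
isEven⇒double (suc (suc n)) ev with isEven⇒double n ev
... | k , ≡.refl = suc k , ≡.refl

n≤double : ∀ n → n ≤ double n
n≤double zero    = z≤n
n≤double (suc n) = s≤s (ℕₚ.m≤n⇒m≤1+n (n≤double n))

double-mono-< : ∀ {m n} → m < n → double m < double n
double-mono-< {zero}  {suc n} _         = s≤s z≤n
double-mono-< {suc m} {suc n} (s≤s m<n) = s≤s (s≤s (double-mono-< m<n))

module _ {c ℓ : Level} (F : Field c ℓ) where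
  open Field F
  open Sprugnoli F

  module FieldProperties where
    open ≈-Reasoning setoid

    1≉0 : ¬ 1# ≈ 0#
    1≉0 1≈0 = 0≉1 (sym 1≈0)

    *-cancelˡ : ∀ {a x y} → ¬ a ≈ 0# → a * x ≈ a * y → x ≈ y
    *-cancelˡ {a} {x} {y} a≉0 ax≈ay = begin
      x                  ≈⟨ sym (*-identityˡ x) ⟩
      1# * x             ≈⟨ *-congʳ (sym a⁻¹a≈1) ⟩
      ((a ⁻¹) * a) * x   ≈⟨ *-assoc _ _ _ ⟩
      (a ⁻¹) * (a * x)   ≈⟨ *-congˡ ax≈ay ⟩
      (a ⁻¹) * (a * y)   ≈⟨ sym (*-assoc _ _ _) ⟩
      ((a ⁻¹) * a) * y   ≈⟨ *-congʳ a⁻¹a≈1 ⟩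
      1# * y             ≈⟨ *-identityˡ y ⟩
      y                  ∎
      where
      a⁻¹a≈1 : (a ⁻¹) * a ≈ 1#
      a⁻¹a≈1 = trans (*-comm _ _) (⁻¹-inverse a a≉0)

    *-nonzero : ∀ {x y} → ¬ x ≈ 0# → ¬ y ≈ 0# → ¬ x * y ≈ 0#
    *-nonzero x≉0 y≉0 xy≈0 = y≉0 (*-cancelˡ x≉0 (trans xy≈0 (sym (zeroʳ _))))

  open FieldProperties

  module Sums where
    open CommutativeSemigroupProperties +-commutativeSemigroup using (interchange)
    open GroupProperties +-group using (∙-cancelˡ)

    Σ<-cong : ∀ n {f g : ℕ → Carrier} → (∀ i → i < n → f i ≈ g i) → Σ< n f ≈ Σ< n g
    Σ<-cong zero    f≈g = refl
    Σ<-cong (suc n) f≈g =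
      +-cong (Σ<-cong n (λ i i<n → f≈g i (ℕₚ.m<n⇒m<1+n i<n))) (f≈g n ℕₚ.≤-refl)

    Σ<-zero : ∀ n {f : ℕ → Carrier} → (∀ i → i < n → f i ≈ 0#) → Σ< n f ≈ 0#
    Σ<-zero zero    f≈0 = refl
    Σ<-zero (suc n) f≈0 =
      trans (+-cong (Σ<-zero n (λ i i<n → f≈0 i (ℕₚ.m<n⇒m<1+n i<n))) (f≈0 n ℕₚ.≤-refl))
            (+-identityʳ 0#)

    Σ<-+ : ∀ n (f g : ℕ → Carrier) → Σ< n (λ i → f i + g i) ≈ Σ< n f + Σ< n g
    Σ<-+ zero    f g = sym (+-identityʳ 0#)
    Σ<-+ (suc n) f g = trans (+-congʳ (Σ<-+ n f g)) (interchange _ _ _ _)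

    *-distribˡ-Σ< : ∀ n a (f : ℕ → Carrier) → a * Σ< n f ≈ Σ< n (λ i → a * f i)
    *-distribˡ-Σ< zero    a f = zeroʳ a
    *-distribˡ-Σ< (suc n) a f = trans (distribˡ a _ _) (+-congʳ (*-distribˡ-Σ< n a f))

    *-distribʳ-Σ< : ∀ n a (f : ℕ → Carrier) → Σ< n f * a ≈ Σ< n (λ i → f i * a)
    *-distribʳ-Σ< n a f =
      trans (*-comm _ _) (trans (*-distribˡ-Σ< n a f) (Σ<-cong n (λ i _ → *-comm _ _)))

    Σ<-unfoldˡ : ∀ n (f : ℕ → Carrier) → Σ< (suc n) f ≈ f 0 + Σ< n (λ i → f (suc i))
    Σ<-unfoldˡ zero    f = trans (+-identityˡ _) (sym (+-identityʳ _))
    Σ<-unfoldˡ (suc n) f = trans (+-congʳ (Σ<-unfoldˡ n f)) (+-assoc _ _ _)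

    Σ<-extend : ∀ {m} n (f : ℕ → Carrier) → m ≤ n →
                (∀ i → m ≤ i → i < n → f i ≈ 0#) → Σ< n f ≈ Σ< m f
    Σ<-extend zero    f z≤n f≈0 = refl
    Σ<-extend (suc n) f m≤1+n f≈0 with ℕₚ.m≤n⇒m<n∨m≡n m≤1+n
    ... | inj₂ ≡.refl         = refl
    ... | inj₁ (s≤s m≤n) =
      trans (+-cong (Σ<-extend n f m≤n (λ i m≤i i<n → f≈0 i m≤i (ℕₚ.m<n⇒m<1+n i<n)))
                    (f≈0 n m≤n ℕₚ.≤-refl))
            (+-identityʳ _)

    Σ<-swap : ∀ m n (f : ℕ → ℕ → Carrier) →
              Σ< m (λ i → Σ< n (f i)) ≈ Σ< n (λ j → Σ< m (λ i → f i j))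
    Σ<-swap zero    n f = sym (Σ<-zero n (λ _ _ → refl))
    Σ<-swap (suc m) n f =
      trans (+-congʳ (Σ<-swap m n f)) (sym (Σ<-+ n (λ j → Σ< m (λ i → f i j)) (f m)))

    Σ<-single : ∀ n p (f : ℕ → Carrier) → p < n → (∀ i → i < n → i ≢ p → f i ≈ 0#) →
                Σ< n f ≈ f p
    Σ<-single (suc n) p f p<1+n f≈0 with ℕₚ.m≤n⇒m<n∨m≡n p<1+n
    ... | inj₂ ≡.refl =
      trans (+-congʳ (Σ<-zero n (λ i i<n → f≈0 i (ℕₚ.m<n⇒m<1+n i<n) (ℕₚ.<⇒≢ i<n))))
            (+-identityˡ _)
    ... | inj₁ (s≤s p<n) =
      trans (+-cong (Σ<-single n p f p<n (λ i i<n → f≈0 i (ℕₚ.m<n⇒m<1+n i<n)))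
                    (f≈0 n ℕₚ.≤-refl (λ n≡p → ℕₚ.<⇒≢ p<n (≡.sym n≡p))))
            (+-identityʳ _)

    Σ<-evenOdd : ∀ n (f : ℕ → Carrier) →
                 Σ< (double n) f ≈ Σ< n (λ k → f (double k)) + Σ< n (λ k → f (suc (double k)))
    Σ<-evenOdd zero    f = sym (+-identityʳ 0#)
    Σ<-evenOdd (suc n) f =
      trans (+-congʳ (+-congʳ (Σ<-evenOdd n f))) (trans (+-assoc _ _ _) (interchange _ _ _ _))

    Σ<-if : ∀ n b (f : ℕ → Carrier) →
            Σ< n (λ i → if b then f i else 0#) ≈ (if b then Σ< n f else 0#)
    Σ<-if n true  f = refl
    Σ<-if n false f = Σ<-zero n (λ _ _ → refl)

    lowerTriangular-injective : (K : ℕ → ℕ → Carrier) → (∀ n → ¬ K n n ≈ 0#) →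
      {z w : ℕ → Carrier} →
      (∀ n → Σ< (suc n) (λ i → K n i * z i) ≈ Σ< (suc n) (λ i → K n i * w i)) →
      ∀ n → z n ≈ w n
    lowerTriangular-injective K Kₙₙ≉0 {z} {w} Kz≈Kw = <-rec _ step
      where
      step : ∀ n → (∀ {i} → i < n → z i ≈ w i) → z n ≈ w n
      step n ih = *-cancelˡ (Kₙₙ≉0 n) (∙-cancelˡ _ _ _
        (trans (+-congʳ (Σ<-cong n (λ i i<n → *-congˡ (sym (ih i<n))))) (Kz≈Kw n)))

  open Sums

  module PowerSeries where
    open ≈-Reasoning setoid

    infix 4 _≋_
    _≋_ : Series → Series → Set ℓ
    a ≋ b = ∀ n → a n ≈ b n

    ≋-isEquivalence : IsEquivalence _≋_
    ≋-isEquivalence = record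
      { refl  = λ _ → refl
      ; sym   = λ a≋b n → sym (a≋b n)
      ; trans = λ a≋b b≋d n → trans (a≋b n) (b≋d n)
      }

    ≋-setoid : Setoid c ℓ
    ≋-setoid = record { isEquivalence = ≋-isEquivalence }

    open Setoid ≋-setoid public using () renaming (refl to ≋-refl; sym to ≋-sym; trans to ≋-trans)
    module ≋-Reasoning = ≈-Reasoning ≋-setoid

    zeroS : Series
    zeroS _ = 0#

    tail : Series → Series
    tail a n = a (suc n)

    +S-congˡ : ∀ a {b b′} → b ≋ b′ → a +S b ≋ a +S b′
    +S-congˡ a b≋b′ n = +-congˡ (b≋b′ n)

    ·-cong : ∀ {a a′ b b′} → a ≋ a′ → b ≋ b′ → a · b ≋ a′ · b′
    ·-cong a≋a′ b≋b′ n = Σ<-cong (suc n) (λ i _ → *-cong (a≋a′ i) (b≋b′ (n ∸ i)))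

    ·-congˡ : ∀ a {b b′} → b ≋ b′ → a · b ≋ a · b′
    ·-congˡ a = ·-cong {a} ≋-refl

    ·-congʳ : ∀ {a a′} b → a ≋ a′ → a · b ≋ a′ · b
    ·-congʳ b a≋a′ = ·-cong {b = b} a≋a′ ≋-refl

    ·-unfold₀ : ∀ a b → (a · b) 0 ≈ a 0 * b 0
    ·-unfold₀ a b = +-identityˡ _

    ·-unfoldˡ : ∀ a b n → (a · b) (suc n) ≈ a 0 * b (suc n) + (tail a · b) n
    ·-unfoldˡ a b n = Σ<-unfoldˡ (suc n) (λ i → a i * b (suc n ∸ i))

    ·-unfoldʳ : ∀ a b n → (a · b) (suc n) ≈ (a · tail b) n + a (suc n) * b 0
    ·-unfoldʳ a b n = +-cong
      (Σ<-cong (suc n) (λ i i≤n →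
        *-congˡ (reflexive (cong b (ℕₚ.+-∸-assoc 1 (ℕₚ.≤-pred i≤n))))))
      (*-congˡ (reflexive (cong b (ℕₚ.n∸n≡0 n))))

    ·-comm : ∀ a b → a · b ≋ b · a
    ·-comm a b zero    = trans (·-unfold₀ a b) (trans (*-comm _ _) (sym (·-unfold₀ b a)))
    ·-comm a b (suc n) = begin
      (a · b) (suc n)                   ≈⟨ ·-unfoldˡ a b n ⟩
      a 0 * b (suc n) + (tail a · b) n  ≈⟨ +-cong (*-comm _ _) (·-comm (tail a) b n) ⟩
      b (suc n) * a 0 + (b · tail a) n  ≈⟨ +-comm _ _ ⟩
      (b · tail a) n + b (suc n) * a 0  ≈⟨ ·-unfoldʳ b a n ⟨
      (b · a) (suc n)                   ∎

    ·-distribʳ : ∀ a a′ b → (a +S a′) · b ≋ (a · b) +S (a′ · b)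
    ·-distribʳ a a′ b n = trans (Σ<-cong (suc n) (λ i _ → distribʳ _ _ _)) (Σ<-+ (suc n) _ _)

    ·-scalarˡ : ∀ k a b n → ((λ m → k * a m) · b) n ≈ k * (a · b) n
    ·-scalarˡ k a b n =
      trans (Σ<-cong (suc n) (λ i _ → *-assoc _ _ _)) (sym (*-distribˡ-Σ< (suc n) k _))

    ·-assoc : ∀ a b d → (a · b) · d ≋ a · (b · d)
    ·-assoc a b d zero = begin
      ((a · b) · d) 0    ≈⟨ ·-unfold₀ (a · b) d ⟩
      (a · b) 0 * d 0    ≈⟨ *-congʳ (·-unfold₀ a b) ⟩
      (a 0 * b 0) * d 0  ≈⟨ *-assoc _ _ _ ⟩
      a 0 * (b 0 * d 0)  ≈⟨ *-congˡ (·-unfold₀ b d) ⟨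
      a 0 * (b · d) 0    ≈⟨ ·-unfold₀ a (b · d) ⟨
      (a · (b · d)) 0    ∎
    ·-assoc a b d (suc n) = begin
      ((a · b) · d) (suc n)
        ≈⟨ ·-unfoldˡ (a · b) d n ⟩
      (a · b) 0 * d (suc n) + (tail (a · b) · d) n
        ≈⟨ +-cong (*-congʳ (·-unfold₀ a b)) (·-congʳ d (·-unfoldˡ a b) n) ⟩
      (a 0 * b 0) * d (suc n) + (((λ m → a 0 * tail b m) +S (tail a · b)) · d) n
        ≈⟨ +-congˡ (·-distribʳ (λ m → a 0 * tail b m) (tail a · b) d n) ⟩
      (a 0 * b 0) * d (suc n) + (((λ m → a 0 * tail b m) · d) n + ((tail a · b) · d) n)
        ≈⟨ +-congˡ (+-cong (·-scalarˡ (a 0) (tail b) d n) (·-assoc (tail a) b d n)) ⟩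
      (a 0 * b 0) * d (suc n) + (a 0 * (tail b · d) n + (tail a · (b · d)) n)
        ≈⟨ +-assoc _ _ _ ⟨
      ((a 0 * b 0) * d (suc n) + a 0 * (tail b · d) n) + (tail a · (b · d)) n
        ≈⟨ +-congʳ (trans (+-congʳ (*-assoc _ _ _)) (sym (distribˡ _ _ _))) ⟩
      a 0 * (b 0 * d (suc n) + (tail b · d) n) + (tail a · (b · d)) n
        ≈⟨ +-congʳ (*-congˡ (·-unfoldˡ b d n)) ⟨
      a 0 * (b · d) (suc n) + (tail a · (b · d)) n
        ≈⟨ ·-unfoldˡ a (b · d) n ⟨
      (a · (b · d)) (suc n)
        ∎

    ·-commutativeSemigroup : CommutativeSemigroup c ℓ
    ·-commutativeSemigroup = record
      { Carrier                = Series
      ; _≈_                    = _≋_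
      ; _∙_                    = _·_
      ; isCommutativeSemigroup = record
        { isSemigroup = record
          { isMagma = record { isEquivalence = ≋-isEquivalence ; ∙-cong = ·-cong }
          ; assoc   = ·-assoc
          }
        ; comm = ·-comm
        }
      }

    open CommutativeSemigroupProperties ·-commutativeSemigroup public
      using () renaming (x∙yz≈y∙xz to ·-exchange)

    ·-zeroˡ : ∀ b → zeroS · b ≋ zeroS
    ·-zeroˡ b n = Σ<-zero (suc n) (λ _ _ → zeroˡ _)

    ·-identityˡ : ∀ b → oneS · b ≋ b
    ·-identityˡ b zero    = trans (·-unfold₀ oneS b) (*-identityˡ _)
    ·-identityˡ b (suc n) =
      trans (·-unfoldˡ oneS b n) (trans (+-cong (*-identityˡ _) (·-zeroˡ b n)) (+-identityʳ _))

    ·-identityʳ : ∀ b → b · oneS ≋ b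
    ·-identityʳ b = ≋-trans (·-comm b oneS) (·-identityˡ b)

    xS-·ˡ : ∀ a b → xS a · b ≋ xS (a · b)
    xS-·ˡ a b zero    = trans (·-unfold₀ (xS a) b) (zeroˡ _)
    xS-·ˡ a b (suc n) = trans (·-unfoldˡ (xS a) b n) (trans (+-congʳ (zeroˡ _)) (+-identityˡ _))

    xS-·ʳ : ∀ a b → a · xS b ≋ xS (a · b)
    xS-·ʳ a b = ≋-trans (·-comm a (xS b))
      (≋-trans (xS-·ˡ b a) (λ { zero → refl ; (suc n) → ·-comm b a n }))

    xS-tail : ∀ a → a 0 ≈ 0# → a ≋ xS (tail a)
    xS-tail a a₀≈0 zero    = a₀≈0
    xS-tail a a₀≈0 (suc n) = refl

    VanishesBelow : ℕ → Series → Set ℓ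
    VanishesBelow p a = ∀ m → m < p → a m ≈ 0#

    ·-vanishesBelow : ∀ p q {a b} → VanishesBelow p a → VanishesBelow q b →
                      VanishesBelow (p ℕ.+ q) (a · b)
    ·-vanishesBelow p q {a} {b} a<p≈0 b<q≈0 m m<p+q = Σ<-zero (suc m) term
      where
      term : ∀ i → i < suc m → a i * b (m ∸ i) ≈ 0#
      term i i≤m with i ℕ.<? p
      ... | yes i<p = trans (*-congʳ (a<p≈0 i i<p)) (zeroˡ _)
      ... | no  i≮p = trans (*-congˡ (b<q≈0 (m ∸ i) m∸i<q)) (zeroʳ _)
        where
        m∸i<q : m ∸ i < q
        m∸i<q = ℕₚ.<-≤-trans (ℕₚ.∸-monoˡ-< m<p+q (ℕₚ.≤-pred i≤m))
          (ℕₚ.≤-trans (ℕₚ.∸-monoʳ-≤ (p ℕ.+ q) (ℕₚ.≮⇒≥ i≮p))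
                      (ℕₚ.≤-reflexive (ℕₚ.m+n∸m≡n p q)))

    ·-leading : ∀ p q {a b} → VanishesBelow p a → VanishesBelow q b →
                (a · b) (p ℕ.+ q) ≈ a p * b q
    ·-leading p q {a} {b} a<p≈0 b<q≈0 =
      trans (Σ<-single (suc (p ℕ.+ q)) p _ (s≤s (ℕₚ.m≤m+n p q)) term)
            (*-congˡ (reflexive (cong b (ℕₚ.m+n∸m≡n p q))))
      where
      term : ∀ i → i < suc (p ℕ.+ q) → i ≢ p → a i * b (p ℕ.+ q ∸ i) ≈ 0#
      term i i≤p+q i≢p with ℕₚ.<-cmp i p
      ... | tri< i<p _ _ = trans (*-congʳ (a<p≈0 i i<p)) (zeroˡ _)
      ... | tri≈ _ i≡p _ = contradiction i≡p i≢p
      ... | tri> _ _ p<i = trans (*-congˡ (b<q≈0 _ p+q∸i<q)) (zeroʳ _)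
        where
        p+q∸i<q : p ℕ.+ q ∸ i < q
        p+q∸i<q = ℕₚ.<-≤-trans (ℕₚ.∸-monoʳ-< p<i (ℕₚ.≤-pred i≤p+q))
                               (ℕₚ.≤-reflexive (ℕₚ.m+n∸m≡n p q))

    ·-cancelˡ : ∀ {a x y} → InF0 a → a · x ≋ a · y → x ≋ y
    ·-cancelˡ {a} {x} {y} a₀≉0 ax≋ay =
      lowerTriangular-injective (λ n i → a (n ∸ i)) aₙ₋ₙ≉0
        (λ n → trans (sym (convolution x n)) (trans (ax≋ay n) (convolution y n)))
      where
      aₙ₋ₙ≉0 : ∀ n → ¬ a (n ∸ n) ≈ 0#
      aₙ₋ₙ≉0 n rewrite ℕₚ.n∸n≡0 n = a₀≉0
      convolution : ∀ v n → (a · v) n ≈ Σ< (suc n) (λ i → a (n ∸ i) * v i)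
      convolution v n = trans (·-comm a v n) (Σ<-cong (suc n) (λ i _ → *-comm _ _))

    ·-cancelˡ-F1 : ∀ {a x y} → InF1 a → a · x ≋ a · y → x ≋ y
    ·-cancelˡ-F1 {a} {x} {y} (a₀≈0 , a₁≉0) ax≋ay = ·-cancelˡ a₁≉0 (λ n → begin
      (tail a · x) n      ≈⟨ xS-·ˡ (tail a) x (suc n) ⟨
      (xS (tail a) · x) (suc n)  ≈⟨ ·-congʳ x (xS-tail a a₀≈0) (suc n) ⟨
      (a · x) (suc n)     ≈⟨ ax≋ay (suc n) ⟩
      (a · y) (suc n)     ≈⟨ ·-congʳ y (xS-tail a a₀≈0) (suc n) ⟩
      (xS (tail a) · y) (suc n)  ≈⟨ xS-·ˡ (tail a) y (suc n) ⟩
      (tail a · y) n      ∎)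

    LowerTriangular : (ℕ → Series) → Set ℓ
    LowerTriangular W = ∀ i → VanishesBelow i (W i)

    linComb : (ℕ → Series) → (ℕ → Carrier) → Series
    linComb W c n = Σ< (suc n) (λ i → c i * W i n)

    linComb-extend : ∀ {W} c → LowerTriangular W → ∀ {n} m → n < m →
                     Σ< m (λ i → c i * W i n) ≈ linComb W c n
    linComb-extend c W-lt m n<m =
      Σ<-extend m _ n<m (λ i n<i _ → trans (*-congˡ (W-lt i _ n<i)) (zeroʳ _))

    ·-linComb : ∀ a {W} c → LowerTriangular W → a · linComb W c ≋ linComb (λ i → a · W i) c
    ·-linComb a {W} c W-lt n = begin
      Σ< (suc n) (λ i → a i * linComb W c (n ∸ i))
        ≈⟨ Σ<-cong (suc n) (λ i _ →
             *-congˡ (sym (linComb-extend c W-lt (suc n) (s≤s (ℕₚ.m∸n≤m n i))))) ⟩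
      Σ< (suc n) (λ i → a i * Σ< (suc n) (λ k → c k * W k (n ∸ i)))
        ≈⟨ Σ<-cong (suc n) (λ i _ → *-distribˡ-Σ< (suc n) (a i) _) ⟩
      Σ< (suc n) (λ i → Σ< (suc n) (λ k → a i * (c k * W k (n ∸ i))))
        ≈⟨ Σ<-swap (suc n) (suc n) _ ⟩
      Σ< (suc n) (λ k → Σ< (suc n) (λ i → a i * (c k * W k (n ∸ i))))
        ≈⟨ Σ<-cong (suc n) (λ k _ → Σ<-cong (suc n) (λ i _ → x*yz≈y*xz _ _ _)) ⟩
      Σ< (suc n) (λ k → Σ< (suc n) (λ i → c k * (a i * W k (n ∸ i))))
        ≈⟨ Σ<-cong (suc n) (λ k _ → *-distribˡ-Σ< (suc n) (c k) _) ⟨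
      linComb (λ i → a · W i) c n
        ∎
      where
      open CommutativeSemigroupProperties *-commutativeSemigroup
        using () renaming (x∙yz≈y∙xz to x*yz≈y*xz)

    linComb-+ : ∀ W c c′ → linComb W (λ i → c i + c′ i) ≋ linComb W c +S linComb W c′
    linComb-+ W c c′ n = trans (Σ<-cong (suc n) (λ _ _ → distribʳ _ _ _)) (Σ<-+ (suc n) _ _)

  open PowerSeries

  module LowerTriangularInverse (T : Matrix) (Tₙₙ≉0 : ∀ n → ¬ T n n ≈ 0#) where
    open ≈-Reasoning setoid

    T⁻¹ : Matrix
    T⁻¹ = lowerTriInverse T

    invUpTo-stable : ∀ {n j} k → j ≤ n → invUpTo T n j k ≡ T⁻¹ j k
    invUpTo-stable {zero}  k z≤n     = ≡.refl
    invUpTo-stable {suc n} {j} k j≤1+n with ℕₚ.m≤n⇒m<n∨m≡n j≤1+n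
    ... | inj₂ ≡.refl      = ≡.refl
    ... | inj₁ (s≤s j≤n) rewrite dec-false (j ℕ.≟ suc n) (ℕₚ.<⇒≢ (s≤s j≤n)) =
      invUpTo-stable k j≤n

    T⁻¹-unfold : ∀ n k →
                 T⁻¹ n k ≈ (T n n ⁻¹) * (δ T n k - Σ< n (λ j → T n j * T⁻¹ j k))
    T⁻¹-unfold zero    k = refl
    T⁻¹-unfold (suc n) k rewrite dec-true (n ℕ.≟ n) ≡.refl =
      *-congˡ (+-congˡ (-‿cong (Σ<-cong (suc n) (λ j j≤n →
        *-congˡ (reflexive (invUpTo-stable k (ℕₚ.≤-pred j≤n)))))))

    δ-diagonal : ∀ n → δ T n n ≈ 1#
    δ-diagonal n = reflexive (cong (if_then 1# else 0#) (dec-true (n ℕ.≟ n) ≡.refl))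

    δ-offDiagonal : ∀ {n k} → n ≢ k → δ T n k ≈ 0#
    δ-offDiagonal {n} {k} n≢k = reflexive (cong (if_then 1# else 0#) (dec-false (n ℕ.≟ k) n≢k))

    T·T⁻¹≈δ : ∀ n k → Σ< (suc n) (λ j → T n j * T⁻¹ j k) ≈ δ T n k
    T·T⁻¹≈δ n k = begin
      S + T n n * T⁻¹ n k                  ≈⟨ +-congˡ (*-congˡ (T⁻¹-unfold n k)) ⟩
      S + T n n * ((T n n ⁻¹) * (δ T n k - S))
        ≈⟨ +-congˡ (trans (sym (*-assoc _ _ _))
                          (trans (*-congʳ (⁻¹-inverse _ (Tₙₙ≉0 n))) (*-identityˡ _))) ⟩
      S + (δ T n k - S)                    ≈⟨ +-comm _ _ ⟩
      (δ T n k - S) + S                    ≈⟨ +-assoc _ _ _ ⟩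
      δ T n k + (- S + S)                  ≈⟨ +-congˡ (-‿inverseˡ S) ⟩
      δ T n k + 0#                         ≈⟨ +-identityʳ _ ⟩
      δ T n k                              ∎
      where
      S : Carrier
      S = Σ< n (λ j → T n j * T⁻¹ j k)

    T⁻¹-upper : ∀ k n → n < k → T⁻¹ n k ≈ 0#
    T⁻¹-upper k = <-rec _ step
      where
      step : ∀ n → (∀ {j} → j < n → j < k → T⁻¹ j k ≈ 0#) → n < k → T⁻¹ n k ≈ 0#
      step n ih n<k = begin
        T⁻¹ n k                                                ≈⟨ T⁻¹-unfold n k ⟩
        (T n n ⁻¹) * (δ T n k - Σ< n (λ j → T n j * T⁻¹ j k))
          ≈⟨ *-congˡ (+-cong (δ-offDiagonal (ℕₚ.<⇒≢ n<k)) (-‿cong (Σ<-zero n (λ j j<n →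
               trans (*-congˡ (ih j<n (ℕₚ.<-trans j<n n<k))) (zeroʳ _))))) ⟩
        (T n n ⁻¹) * (0# - 0#)                                 ≈⟨ *-congˡ (-‿inverseʳ 0#) ⟩
        (T n n ⁻¹) * 0#                                        ≈⟨ zeroʳ _ ⟩
        0#                                                     ∎

    T·T⁻¹y≈y : ∀ (y : ℕ → Carrier) n →
      Σ< (suc n) (λ i → T n i * Σ< (suc i) (λ j → T⁻¹ i j * y j)) ≈ y n
    T·T⁻¹y≈y y n = begin
      Σ< (suc n) (λ i → T n i * Σ< (suc i) (λ j → T⁻¹ i j * y j))
        ≈⟨ Σ<-cong (suc n) (λ i i≤n → *-congˡ (sym (Σ<-extend (suc n) _ i≤n (λ j i<j _ →
             trans (*-congʳ (T⁻¹-upper j i i<j)) (zeroˡ _))))) ⟩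
      Σ< (suc n) (λ i → T n i * Σ< (suc n) (λ j → T⁻¹ i j * y j))
        ≈⟨ Σ<-cong (suc n) (λ i _ → *-distribˡ-Σ< (suc n) (T n i) _) ⟩
      Σ< (suc n) (λ i → Σ< (suc n) (λ j → T n i * (T⁻¹ i j * y j)))
        ≈⟨ Σ<-swap (suc n) (suc n) _ ⟩
      Σ< (suc n) (λ j → Σ< (suc n) (λ i → T n i * (T⁻¹ i j * y j)))
        ≈⟨ Σ<-cong (suc n) (λ j _ → trans (Σ<-cong (suc n) (λ i _ → sym (*-assoc _ _ _)))
                                           (sym (*-distribʳ-Σ< (suc n) (y j) _))) ⟩
      Σ< (suc n) (λ j → Σ< (suc n) (λ i → T n i * T⁻¹ i j) * y j)
        ≈⟨ Σ<-cong (suc n) (λ j _ → *-congʳ (T·T⁻¹≈δ n j)) ⟩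
      Σ< (suc n) (λ j → δ T n j * y j)
        ≈⟨ Σ<-single (suc n) n _ ℕₚ.≤-refl (λ j _ j≢n →
             trans (*-congʳ (δ-offDiagonal (λ n≡j → j≢n (≡.sym n≡j)))) (zeroˡ _)) ⟩
      δ T n n * y n
        ≈⟨ trans (*-congʳ (δ-diagonal n)) (*-identityˡ _) ⟩
      y n
        ∎

  module ParityParts where

    Even : Series → Set ℓ
    Even a = ∀ n → isEven n ≡ false → a n ≈ 0#

    parityPart : Bool → Series → Series
    parityPart b a n = if does (isEven n ≟ᵇ b) then a n else 0#

    evenPart oddPart : Series → Series
    evenPart = parityPart true
    oddPart  = parityPart false

    Even-oneS : Even oneS
    Even-oneS zero    ()
    Even-oneS (suc n) _ = refl

    Even-· : ∀ {a b} → Even a → Even b → Even (a · b)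
    Even-· {a} {b} a-even b-even n n-odd = Σ<-zero (suc n) term
      where
      term : ∀ i → i < suc n → a i * b (n ∸ i) ≈ 0#
      term i i≤n with isEven i in i-parity
      ... | true  = trans (*-congˡ (b-even (n ∸ i)
                      (≡.trans (isEven-∸ (ℕₚ.≤-pred i≤n) i-parity) n-odd))) (zeroʳ _)
      ... | false = trans (*-congʳ (a-even i i-parity)) (zeroˡ _)

    parityPart-cong : ∀ b {a a′} → a ≋ a′ → parityPart b a ≋ parityPart b a′
    parityPart-cong b a≋a′ n with does (isEven n ≟ᵇ b)
    ... | true  = a≋a′ n
    ... | false = refl

    parityPart-+ : ∀ b a a′ → parityPart b (a +S a′) ≋ parityPart b a +S parityPart b a′
    parityPart-+ b a a′ n with does (isEven n ≟ᵇ b)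
    ... | true  = refl
    ... | false = sym (+-identityʳ 0#)

    parityPart-· : ∀ b {e} a → Even e → parityPart b (e · a) ≋ e · parityPart b a
    parityPart-· b {e} a e-even n =
      sym (trans (Σ<-cong (suc n) term) (Σ<-if (suc n) (does (isEven n ≟ᵇ b)) _))
      where
      oddTerm : ∀ {i} → isEven i ≡ false → ∀ x → e i * x ≈ 0#
      oddTerm i-odd x = trans (*-congʳ (e-even _ i-odd)) (zeroˡ x)
      term : ∀ i → i < suc n →
             e i * parityPart b a (n ∸ i) ≈ (if does (isEven n ≟ᵇ b) then e i * a (n ∸ i) else 0#)
      term i i≤n with isEven i in i-parity
      ... | true rewrite isEven-∸ (ℕₚ.≤-pred i≤n) i-parity with does (isEven n ≟ᵇ b)
      ...   | true  = refl
      ...   | false = zeroʳ _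
      term i i≤n | false with does (isEven n ≟ᵇ b)
      ...   | true  = trans (oddTerm i-parity _) (sym (oddTerm i-parity _))
      ...   | false = oddTerm i-parity _

    evenPart-even : ∀ {e} → Even e → evenPart e ≋ e
    evenPart-even e-even n with isEven n in n-parity
    ... | true  = refl
    ... | false = sym (e-even n n-parity)

    oddPart-even : ∀ {e} → Even e → oddPart e ≋ zeroS
    oddPart-even e-even n with isEven n in n-parity
    ... | true  = refl
    ... | false = e-even n n-parity

    OddSeries-vanishes : ∀ a → OddSeries a → ∀ n → isEven n ≡ true → a n ≈ 0#
    OddSeries-vanishes a a-odd n n-even with isEven⇒double n n-even
    ... | k , ≡.refl = trans (reflexive (cong a (double≡2* k))) (a-odd k)

    oddPart-odd : ∀ a → OddSeries a → oddPart a ≋ a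
    oddPart-odd a a-odd n with isEven n in n-parity
    ... | true  = sym (OddSeries-vanishes a a-odd n n-parity)
    ... | false = refl

    evenPart-odd : ∀ a → OddSeries a → evenPart a ≋ zeroS
    evenPart-odd a a-odd n with isEven n in n-parity
    ... | true  = OddSeries-vanishes a a-odd n n-parity
    ... | false = refl

    Even-xS : ∀ a → OddSeries a → Even (xS a)
    Even-xS a a-odd zero    ()
    Even-xS a a-odd (suc n) n-odd =
      OddSeries-vanishes a a-odd n (isEven-pred n n-odd)

    evenPart-xS : ∀ a → evenPart (xS a) ≋ xS (oddPart a)
    evenPart-xS a zero    = refl
    evenPart-xS a (suc n) rewrite isEven-suc n with isEven n
    ... | true  = refl
    ... | false = refl

  open ParityParts

  module OrderTwoPowers (u : Series) (u-vanishesBelow2 : VanishesBelow 2 u) (u₂≉0 : ¬ u 2 ≈ 0#)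
    where

    powS-vanishesBelow : ∀ k → VanishesBelow (double k) (powS u k)
    powS-vanishesBelow zero    m ()
    powS-vanishesBelow (suc k) =
      ·-vanishesBelow 2 (double k) u-vanishesBelow2 (powS-vanishesBelow k)

    powS-leading : ∀ k → ¬ powS u k (double k) ≈ 0#
    powS-leading zero    = 1≉0
    powS-leading (suc k) uᵏ⁺¹≈0 = *-nonzero u₂≉0 (powS-leading k)
      (trans (sym (·-leading 2 (double k) u-vanishesBelow2 (powS-vanishesBelow k))) uᵏ⁺¹≈0)

    powS-lowerTriangular : LowerTriangular (powS u)
    powS-lowerTriangular k m m<k = powS-vanishesBelow k m (ℕₚ.<-≤-trans m<k (n≤double k))

    powerSum : (ℕ → Carrier) → Series
    powerSum = linComb (powS u)

    Even-powerSum : Even u → ∀ d → Even (powerSum d)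
    Even-powerSum u-even d n n-odd =
      Σ<-zero (suc n) (λ k _ → trans (*-congˡ (Even-powS k n n-odd)) (zeroʳ _))
      where
      Even-powS : ∀ k → Even (powS u k)
      Even-powS zero    = Even-oneS
      Even-powS (suc k) = Even-· u-even (Even-powS k)

    ·-powerSum : ∀ d → u · powerSum d ≋ powerSum (xS d)
    ·-powerSum d n = begin
      (u · powerSum d) n                                  ≈⟨ ·-linComb u d powS-lowerTriangular n ⟩
      Σ< (suc n) (λ k → d k * powS u (suc k) n)
        ≈⟨ Σ<-extend (suc n) _ (ℕₚ.n≤1+n n) (λ k n≤k _ →
             trans (*-congˡ (powS-lowerTriangular (suc k) n (s≤s n≤k))) (zeroʳ _)) ⟩
      Σ< n (λ k → d k * powS u (suc k) n)                 ≈⟨ +-identityˡ _ ⟨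
      0# + Σ< n (λ k → d k * powS u (suc k) n)            ≈⟨ +-congʳ (zeroˡ _) ⟨
      0# * oneS n + Σ< n (λ k → d k * powS u (suc k) n)  ≈⟨ Σ<-unfoldˡ n _ ⟨
      powerSum (xS d) n                                   ∎
      where open ≈-Reasoning setoid

    powerSum-injective : ∀ {d} → powerSum d ≋ zeroS → ∀ k → d k ≈ 0#
    powerSum-injective {d} Σdₖuᵏ≋0 =
      lowerTriangular-injective (λ m k → powS u k (double m)) powS-leading
        (λ m → trans (coefficient m)
                 (trans (Σdₖuᵏ≋0 (double m)) (sym (Σ<-zero (suc m) (λ _ _ → zeroʳ _)))))
      where
      coefficient : ∀ m → Σ< (suc m) (λ k → powS u k (double m) * d k) ≈ powerSum d (double m)
      coefficient m = trans (Σ<-cong (suc m) (λ _ _ → *-comm _ _))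
        (sym (Σ<-extend (suc (double m)) _ (s≤s (n≤double m))
          (λ k m<k _ →
            trans (*-congˡ (powS-vanishesBelow k (double m) (double-mono-< m<k))) (zeroʳ _))))

  module SprugnoliArray (g f1 f2 : Series) (g∈F0 : InF0 g) (f1∈F1 : InF1 f1) (f2∈F1 : InF1 f2)
    (f2-odd : OddSeries f2) where

    u : Series
    u = xS f2

    u-vanishesBelow2 : VanishesBelow 2 u
    u-vanishesBelow2 zero          _ = refl
    u-vanishesBelow2 (suc zero)    _ = proj₁ f2∈F1
    u-vanishesBelow2 (suc (suc m)) (s≤s (s≤s ()))

    open OrderTwoPowers u u-vanishesBelow2 (proj₂ f2∈F1) public

    columnSeries : ℕ → Series
    columnSeries zero          = oneS
    columnSeries (suc zero)    = f1
    columnSeries (suc (suc i)) = u · columnSeries i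

    columnSeries-lowerTriangular : LowerTriangular columnSeries
    columnSeries-lowerTriangular zero          m       ()
    columnSeries-lowerTriangular (suc zero)    zero    _ = proj₁ f1∈F1
    columnSeries-lowerTriangular (suc zero)    (suc m) (s≤s ())
    columnSeries-lowerTriangular (suc (suc i)) =
      ·-vanishesBelow 2 i u-vanishesBelow2 (columnSeries-lowerTriangular i)

    columnSeries-leading : ∀ i → ¬ columnSeries i i ≈ 0#
    columnSeries-leading zero          = 1≉0
    columnSeries-leading (suc zero)    = proj₂ f1∈F1
    columnSeries-leading (suc (suc i)) Wᵢ₊₂≈0 = *-nonzero (proj₂ f2∈F1) (columnSeries-leading i)
      (trans (sym (·-leading 2 i u-vanishesBelow2 (columnSeries-lowerTriangular i))) Wᵢ₊₂≈0)

    columnSeries-double : ∀ k → columnSeries (double k) ≋ powS u k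
    columnSeries-double zero    = ≋-refl
    columnSeries-double (suc k) = ·-congˡ u (columnSeries-double k)

    columnSeries-suc-double : ∀ k → columnSeries (suc (double k)) ≋ f1 · powS u k
    columnSeries-suc-double zero    = ≋-sym (·-identityʳ f1)
    columnSeries-suc-double (suc k) =
      ≋-trans (·-congˡ u (columnSeries-suc-double k)) (·-exchange u f1 (powS u k))

    M : Matrix
    M = sprugnoliMatrix g f1 f2

    column : Matrix → ℕ → Series
    column T k n = T n k

    column-M : ∀ i → column M i ≋ g · columnSeries i
    column-M zero          = ·-identityʳ (g · oneS)
    column-M (suc zero)    = ≋-trans (·-identityʳ _) (·-congˡ g (·-identityʳ f1))
    column-M (suc (suc i)) rewrite m/n≡1+[m∸n]/n {suc (suc i)} {2} (s≤s (s≤s z≤n)) =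
      ≋-trans (·-exchange (g · powS f1 (i ℕ.% 2)) u (powS u (i ℕ./ 2)))
        (≋-trans (·-congˡ u (column-M i)) (·-exchange u g (columnSeries i)))

    M-diagonal≉0 : ∀ n → ¬ M n n ≈ 0#
    M-diagonal≉0 n Mₙₙ≈0 = *-nonzero g∈F0 (columnSeries-leading n)
      (trans (sym (·-leading 0 n (λ _ ()) (columnSeries-lowerTriangular n)))
             (trans (sym (column-M n n)) Mₙₙ≈0))

    M·c≈g·linComb : ∀ c n → Σ< (suc n) (λ i → M n i * c i) ≈ (g · linComb columnSeries c) n
    M·c≈g·linComb c n =
      trans (Σ<-cong (suc n) (λ i _ → trans (*-comm _ _) (*-congˡ (column-M i n))))
            (sym (·-linComb g c columnSeries-lowerTriangular n))

    P : Matrix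
    P = productionMatrix M

    open LowerTriangularInverse M M-diagonal≉0 using (T·T⁻¹y≈y)

    -- Column k of M P = M̄, in generating-function form.
    column-P : ∀ k → g · linComb columnSeries (column P k) ≋ tail (column M k)
    column-P k n = trans (sym (M·c≈g·linComb (column P k) n)) (T·T⁻¹y≈y (λ j → M (suc j) k) n)

    linComb-column-P₁ : linComb columnSeries (column P 1) ≋ tail f1
    linComb-column-P₁ = ·-cancelˡ g∈F0 (≋-trans (column-P 1) (λ n →
      trans (column-M 1 (suc n))
            (trans (·-congˡ g (xS-tail f1 (proj₁ f1∈F1)) (suc n)) (xS-·ʳ g (tail f1) (suc n)))))

    linComb-column-P₂ : linComb columnSeries (column P 2) ≋ f2
    linComb-column-P₂ = ·-cancelˡ g∈F0 (≋-trans (column-P 2) (λ n →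
      trans (column-M 2 (suc n)) (trans (·-congˡ g (·-identityʳ u) (suc n)) (xS-·ʳ g f2 (suc n)))))

    evenCoeffs oddCoeffs : (ℕ → Carrier) → ℕ → Carrier
    evenCoeffs c k = c (double k)
    oddCoeffs  c k = c (suc (double k))

    linComb-columnSeries : ∀ c →
      linComb columnSeries c ≋ powerSum (evenCoeffs c) +S (powerSum (oddCoeffs c) · f1)
    linComb-columnSeries c n = begin
      linComb columnSeries c n
        ≈⟨ linComb-extend c columnSeries-lowerTriangular (double (suc n))
                          (s≤s (ℕₚ.m≤n⇒m≤1+n (n≤double n))) ⟨
      Σ< (double (suc n)) (λ i → c i * columnSeries i n)
        ≈⟨ Σ<-evenOdd (suc n) (λ i → c i * columnSeries i n) ⟩
      Σ< (suc n) (λ k → evenCoeffs c k * columnSeries (double k) n) +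
      Σ< (suc n) (λ k → oddCoeffs c k * columnSeries (suc (double k)) n)
        ≈⟨ +-cong (Σ<-cong (suc n) (λ k _ → *-congˡ (columnSeries-double k n)))
                  (Σ<-cong (suc n) (λ k _ → *-congˡ (columnSeries-suc-double k n))) ⟩
      powerSum (evenCoeffs c) n + linComb (λ k → f1 · powS u k) (oddCoeffs c) n
        ≈⟨ +-congˡ (trans (sym (·-linComb f1 (oddCoeffs c) powS-lowerTriangular n))
                          (·-comm f1 _ n)) ⟩
      powerSum (evenCoeffs c) n + (powerSum (oddCoeffs c) · f1) n
        ∎
      where open ≈-Reasoning setoid

    powerSum-even : ∀ d → Even (powerSum d)
    powerSum-even = Even-powerSum (Even-xS f2 f2-odd)

    parityPart-linComb : ∀ b c → parityPart b (linComb columnSeries c) ≋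
      parityPart b (powerSum (evenCoeffs c)) +S (powerSum (oddCoeffs c) · parityPart b f1)
    parityPart-linComb b c =
      ≋-trans (parityPart-cong b (linComb-columnSeries c))
      (≋-trans (parityPart-+ b _ _)
      (+S-congˡ _ (parityPart-· b f1 (powerSum-even (oddCoeffs c)))))

    oddPart-linComb : ∀ c → oddPart (linComb columnSeries c) ≋ powerSum (oddCoeffs c) · oddPart f1
    oddPart-linComb c n = trans (parityPart-linComb false c n)
      (trans (+-congʳ (oddPart-even (powerSum-even (evenCoeffs c)) n)) (+-identityˡ _))

    evenPart-linComb : ∀ c → evenPart (linComb columnSeries c) ≋
      powerSum (evenCoeffs c) +S (powerSum (oddCoeffs c) · evenPart f1)
    evenPart-linComb c n =
      trans (parityPart-linComb true c n) (+-congʳ (evenPart-even (powerSum-even (evenCoeffs c)) n))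

    p₁ p₂ : ℕ → Carrier
    p₁ = column P 1
    p₂ = column P 2

    O₁ E₂ O₂ : Series
    O₁ = powerSum (oddCoeffs p₁)
    E₂ = powerSum (evenCoeffs p₂)
    O₂ = powerSum (oddCoeffs p₂)

    oddPart-tail-f1 : oddPart (tail f1) ≋ O₁ · oddPart f1
    oddPart-tail-f1 = ≋-trans (parityPart-cong false (≋-sym linComb-column-P₁)) (oddPart-linComb p₁)

    f2≋O₂·oddPart-f1 : f2 ≋ O₂ · oddPart f1
    f2≋O₂·oddPart-f1 = ≋-trans (≋-sym (oddPart-odd f2 f2-odd))
      (≋-trans (parityPart-cong false (≋-sym linComb-column-P₂)) (oddPart-linComb p₂))

    E₂+O₂·evenPart-f1≋0 : E₂ +S (O₂ · evenPart f1) ≋ zeroS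
    E₂+O₂·evenPart-f1≋0 = ≋-trans (≋-sym (evenPart-linComb p₂))
      (≋-trans (parityPart-cong true linComb-column-P₂) (evenPart-odd f2 f2-odd))

    u·O₁≋O₂·evenPart-f1 : u · O₁ ≋ O₂ · evenPart f1
    u·O₁≋O₂·evenPart-f1 = ·-cancelˡ-F1 {oddPart f1} (refl , proj₂ f1∈F1) (begin
      oddPart f1 · (u · O₁)              ≈⟨ ·-exchange (oddPart f1) u O₁ ⟩
      u · (oddPart f1 · O₁)              ≈⟨ ·-congˡ u (·-comm (oddPart f1) O₁) ⟩
      u · (O₁ · oddPart f1)              ≈⟨ ·-congˡ u oddPart-tail-f1 ⟨
      xS f2 · oddPart (tail f1)          ≈⟨ xS-·ˡ f2 (oddPart (tail f1)) ⟩
      xS (f2 · oddPart (tail f1))        ≈⟨ xS-·ʳ f2 (oddPart (tail f1)) ⟨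
      f2 · xS (oddPart (tail f1))        ≈⟨ ·-congˡ f2 (evenPart-xS (tail f1)) ⟨
      f2 · evenPart (xS (tail f1))
        ≈⟨ ·-congˡ f2 (parityPart-cong true (xS-tail f1 (proj₁ f1∈F1))) ⟨
      f2 · evenPart f1                   ≈⟨ ·-congʳ (evenPart f1) f2≋O₂·oddPart-f1 ⟩
      (O₂ · oddPart f1) · evenPart f1    ≈⟨ ·-assoc O₂ (oddPart f1) (evenPart f1) ⟩
      O₂ · (oddPart f1 · evenPart f1)    ≈⟨ ·-exchange O₂ (oddPart f1) (evenPart f1) ⟩
      oddPart f1 · (O₂ · evenPart f1)    ∎)
      where open ≋-Reasoning

    powerSum-p₂-even+p₁-odd≋0 : powerSum (λ k → evenCoeffs p₂ k + xS (oddCoeffs p₁) k) ≋ zeroS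
    powerSum-p₂-even+p₁-odd≋0 = begin
      powerSum (λ k → evenCoeffs p₂ k + xS (oddCoeffs p₁) k)
        ≈⟨ linComb-+ (powS u) (evenCoeffs p₂) (xS (oddCoeffs p₁)) ⟩
      E₂ +S powerSum (xS (oddCoeffs p₁))  ≈⟨ +S-congˡ E₂ (·-powerSum (oddCoeffs p₁)) ⟨
      E₂ +S (u · O₁)                      ≈⟨ +S-congˡ E₂ u·O₁≋O₂·evenPart-f1 ⟩
      E₂ +S (O₂ · evenPart f1)            ≈⟨ E₂+O₂·evenPart-f1≋0 ⟩
      zeroS                               ∎
      where open ≋-Reasoning

mainTheorem11 : ∀ {c ℓ} (F : Field c ℓ) → Sprugnoli.CharZero F →
    (g f1 f2 : Sprugnoli.Series F) →
    Sprugnoli.InF0 F g → Sprugnoli.InF1 F f1 → Sprugnoli.InF1 F f2 →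
    Sprugnoli.OddSeries F f2 →
    let P = Sprugnoli.productionMatrix F (Sprugnoli.sprugnoliMatrix F g f1 f2)
    in Sprugnoli.EvenSeries F (Sprugnoli._+S_ F (Sprugnoli.seriesA F P) (Sprugnoli.seriesB F P))
mainTheorem11 F _ g f1 f2 g∈F0 f1∈F1 f2∈F1 f2-odd m rewrite ≡.sym (double≡2* m) =
  trans (+-comm _ _) (powerSum-injective powerSum-p₂-even+p₁-odd≋0 (suc m))
  where
  open Field F
  open SprugnoliArray F g f1 f2 g∈F0 f1∈F1 f2∈F1 f2-odd
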